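{- Let $m$ be a positive integer and let $\Gamma=\mathrm{Cay}(\mathbb{Z}_{2m},S)$ be a circulant graph. If the Cayley graph $\mathrm{Cay}\big(\mathbb{Z}_{2m},(S\setminus\{m\})+m\big)$ has an automorphism fixing $0$ but moving $m$, then $\Gamma$ is unstable.
   Context: For an additive group $G$ and an inverse-closed subset $S\subseteq G\setminus\{0\}$, the Cayley graph $\mathrm{Cay}(G,S)$ has vertex set $G$, with $x\sim y$ iff $y-x\in S$; it is a circulant graph when $G$ is cyclic. For $A\subseteq G$ and $g\in G$, $A+g=\{a+g: a\in A\}$. A graph $\Lambda$ is stable if $\mathrm{Aut}(\Lambda\times K_2)=\mathrm{Aut}(\Lambda)\times\mathrm{Aut}(K_2)$, where $\Lambda\times K_2$ is the direct product (vertex set $V(\Lambda)\times V(K_2)$, $(a,x)\sim(b,y)$ iff $a\sim b$ and $x\sim y$) on which $\mathrm{Aut}(\Lambda)\times\mathrm{Aut}(K_2)$ acts coordinatewise; otherwise $\Lambda$ is unstable. -}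

module Defs where

open import Data.Nat using (ℕ; zero; suc; _+_; _∸_; NonZero)
open import Data.Nat.DivMod using (_mod_)
open import Data.Fin using (Fin; toℕ)
open import Data.Fin.Subset using (Subset; _∈_; _∉_)
open import Data.Bool using (Bool)
open import Data.Product using (_×_; _,_; Σ; ∃; ∃-syntax)
open import Relation.Binary.PropositionalEquality using (_≡_; _≢_)
open import Relation.Nullary using (¬_)
open import Function.Bundles using (_↔_; _⇔_; Inverse)

record Graph : Set₁ where
  field
    V   : Set
    Adj : V → V → Set
open Graph public

record Aut (Λ : Graph) : Set where
  field
    perm : V Λ ↔ V Λ
  open Inverse perm public using (to; from)
  field
    adj  : ∀ x y → Adj Λ x y ⇔ Adj Λ (to x) (to y)
open Aut public using (perm; adj)

apply : {Λ : Graph} → Aut Λ → V Λ → V Λ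
apply σ = Inverse.to (Aut.perm σ)

K₂ : Graph
K₂ = record { V = Bool ; Adj = λ x y → x ≢ y }

_×G_ : Graph → Graph → Graph
Λ ×G Δ = record
  { V   = V Λ × V Δ
  ; Adj = λ { (a , x) (b , y) → Adj Λ a b × Adj Δ x y } }

Stable : Graph → Set
Stable Λ = (φ : Aut (Λ ×G K₂)) →
  Σ (Aut Λ) λ σ → Σ (Aut K₂) λ τ →
    ∀ a x → apply φ (a , x) ≡ (apply σ a , apply τ x)

Unstable : Graph → Set
Unstable Λ = ¬ Stable Λ

double-nonZero : (m : ℕ) {{_ : NonZero m}} → NonZero (m + m)
double-nonZero (suc k) = _

module Cyclic (m : ℕ) {{m≢0 : NonZero m}} where

  N : ℕ
  N = m + m

  nzN : NonZero N
  nzN = double-nonZero m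

  ZZ : Set
  ZZ = Fin N

  _⊕_ : ZZ → ZZ → ZZ
  x ⊕ y = _mod_ (toℕ x + toℕ y) N {{nzN}}

  ⊖_ : ZZ → ZZ
  ⊖ x = _mod_ (N ∸ toℕ x) N {{nzN}}

  _⊝_ : ZZ → ZZ → ZZ
  y ⊝ x = y ⊕ (⊖ x)

  𝟘 : ZZ
  𝟘 = _mod_ 0 N {{nzN}}

  𝕞 : ZZ
  𝕞 = _mod_ m N {{nzN}}

  Cay : (ZZ → Set) → Graph
  Cay S = record { V = ZZ ; Adj = λ x y → S (y ⊝ x) }

  InvClosed : Subset N → Set
  InvClosed S = ∀ x → x ∈ S → (⊖ x) ∈ S

  shiftSet : Subset N → ZZ → Set
  shiftSet S z = ∃[ s ] (s ∈ S × s ≢ 𝕞 × z ≡ s ⊕ 𝕞)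

{-# OPTIONS --safe #-}
module Submission where

-- The argument works in any abelian group G with an element m of order 2, so that −m = m.
-- Away from d = 0, d ∈ (S ∖ {m}) + m iff d + m ∈ S; hence an automorphism φ of
-- Cay(G, (S ∖ {m}) + m) preserves the relation "v − u + m ∈ S" on all pairs u, v.
-- Twisting the second layer of Cay(G, S) × K₂ by x ↦ x + m turns its edges, which join
-- (a, i) to (b, 1 − i) with b − a ∈ S, into pairs of exactly that kind, so
-- (x, 0) ↦ (φ x, 0), (x, 1) ↦ (φ (x + m) + m, 1) is an automorphism of Cay(G, S) × K₂.
-- If it were of the form σ × τ, then (0, 0) and (0, 1) would have images with equal first
-- coordinates, i.e. φ 0 = φ m + m, which forces φ m = m when φ 0 = 0.

open import Defs
open import Algebra.Bundles using (AbelianGroup)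
open import Algebra.Consequences.Propositional using (comm∧idˡ⇒id; comm∧invˡ⇒inv)
open import Algebra.Core using (Op₁; Op₂)
open import Algebra.Structures using (IsAbelianGroup)
import Algebra.Properties.AbelianGroup as AbelianGroupProperties
open import Data.Bool using (Bool; true; false)
open import Data.Empty using (⊥-elim)
open import Data.Fin using (toℕ)
open import Data.Fin.Properties using (toℕ-injective; toℕ-fromℕ<; toℕ<n; _≟_)
open import Data.Fin.Subset using (Subset; _∈_; _∉_)
open import Data.Nat using (ℕ; NonZero; _%_; _∸_) renaming (_+_ to _+ℕ_)
open import Data.Nat.DivMod using (_mod_; %-distribˡ-+; m%n<n; m<n⇒m%n≡m; [m+n]%n≡m%n)
open import Data.Nat.Properties using (+-assoc; +-comm; m∸n+n≡m; <⇒≤)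
open import Data.Product using (Σ; _×_; _,_; proj₁; ∃-syntax)
open import Function.Bundles using (_↔_; _⇔_; Inverse; Injection; mk↔ₛ′; mk⇔; Equivalence)
open import Function.Construct.Composition using (_↔-∘_)
open import Function.Construct.Symmetry using (⇔-sym)
open import Function.Properties.Inverse using (↔⇒↣)
open import Function.Related.Propositional using (≡⇒; module EquationalReasoning)
open import Relation.Binary.Definitions using (DecidableEquality)
open import Relation.Binary.PropositionalEquality
  using (_≡_; _≢_; refl; sym; trans; cong; cong₂; subst; isEquivalence; module ≡-Reasoning)
open import Relation.Nullary using (yes; no)

Stable⇒layers-agree : {Λ : Graph} → Stable Λ → (φ : Aut (Λ ×G K₂)) →
  ∀ a → proj₁ (apply φ (a , false)) ≡ proj₁ (apply φ (a , true))
Stable⇒layers-agree stable φ a with stable φ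
... | _ , _ , φ≡σ×τ = trans (cong proj₁ (φ≡σ×τ a false)) (sym (cong proj₁ (φ≡σ×τ a true)))

layerwise-↔ : {A B : Set} → (B → A ↔ A) → (A × B) ↔ (A × B)
layerwise-↔ π = mk↔ₛ′
  (λ (x , i) → Inverse.to (π i) x , i)
  (λ (x , i) → Inverse.from (π i) x , i)
  (λ (x , i) → cong (_, i) (Inverse.strictlyInverseˡ (π i) x))
  (λ (x , i) → cong (_, i) (Inverse.strictlyInverseʳ (π i) x))

conjugate-↔ : {A : Set} (h : A → A) → (∀ x → h (h x) ≡ x) → A ↔ A → A ↔ A
conjugate-↔ {A} h h-involutive f = h↔ ↔-∘ (f ↔-∘ h↔)
  where
  h↔ : A ↔ A
  h↔ = mk↔ₛ′ h h h-involutive h-involutive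

module ShiftedCayley
  {G : Set} {plus : Op₂ G} {0# : G} {negate : Op₁ G}
  (isAbelianGroup : IsAbelianGroup _≡_ plus 0# negate)
  (_≟G_ : DecidableEquality G)
  (m : G) (m+m≡0 : plus m m ≡ 0#)
  where

  infixl 6 _+_ _-_
  infix 8 -_

  _+_ : Op₂ G
  _+_ = plus

  -_ : Op₁ G
  -_ = negate

  _-_ : Op₂ G
  y - x = y + (- x)

  open IsAbelianGroup isAbelianGroup using (assoc; comm; identityˡ; identityʳ; inverseʳ)
  private
    abelianGroup : AbelianGroup _ _
    abelianGroup = record { isAbelianGroup = isAbelianGroup }

  open AbelianGroupProperties abelianGroup
    using (inverseʳ-unique; x∙y⁻¹≈ε⇒x≈y; ⁻¹-∙-comm)

  Cay : (G → Set) → Graph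
  Cay S = record { V = G ; Adj = λ x y → S (y - x) }

  shiftSet : (G → Set) → G → Set
  shiftSet S z = ∃[ s ] (S s × s ≢ m × z ≡ s + m)

  x≡y+m⇒x+m≡y : ∀ {x y} → x ≡ y + m → x + m ≡ y
  x≡y+m⇒x+m≡y {x} {y} x≡y+m = begin
    x + m        ≡⟨ cong (_+ m) x≡y+m ⟩
    y + m + m    ≡⟨ assoc y m m ⟩
    y + (m + m)  ≡⟨ cong (y +_) m+m≡0 ⟩
    y + 0#       ≡⟨ identityʳ y ⟩
    y            ∎
    where open ≡-Reasoning

  -m≡m : - m ≡ m
  -m≡m = sym (inverseʳ-unique m m m+m≡0)

  [x+m]-y≡x-y+m : ∀ x y → (x + m) - y ≡ x - y + m
  [x+m]-y≡x-y+m x y = begin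
    x + m + - y      ≡⟨ assoc x m (- y) ⟩
    x + (m + - y)    ≡⟨ cong (x +_) (comm m (- y)) ⟩
    x + (- y + m)    ≡⟨ assoc x (- y) m ⟨
    x + - y + m      ∎
    where open ≡-Reasoning

  x-[y+m]≡x-y+m : ∀ x y → x - (y + m) ≡ x - y + m
  x-[y+m]≡x-y+m x y = begin
    x + - (y + m)    ≡⟨ cong (x +_) (⁻¹-∙-comm y m) ⟨
    x + (- y + - m)  ≡⟨ cong (λ z → x + (- y + z)) -m≡m ⟩
    x + (- y + m)    ≡⟨ assoc x (- y) m ⟨
    x + - y + m      ∎
    where open ≡-Reasoning

  shift : Bool → G → G
  shift false x = x
  shift true  x = x + m

  shift-involutive : ∀ i x → shift i (shift i x) ≡ x
  shift-involutive false x = refl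
  shift-involutive true  x = x≡y+m⇒x+m≡y refl

  shift-difference : ∀ {i j} → i ≢ j → ∀ x y → shift j y - shift i x ≡ y - x + m
  shift-difference {false} {false} i≢j = ⊥-elim (i≢j refl)
  shift-difference {true}  {true}  i≢j = ⊥-elim (i≢j refl)
  shift-difference {false} {true}  _ x y = [x+m]-y≡x-y+m y x
  shift-difference {true}  {false} _ x y = x-[y+m]≡x-y+m y x

  module _ (S : G → Set) where

    shiftSet⇔ : ∀ {d} → d ≢ 0# → shiftSet S d ⇔ S (d + m)
    shiftSet⇔ {d} d≢0 = mk⇔
      (λ (s , s∈S , _ , d≡s+m) → subst S (sym (x≡y+m⇒x+m≡y d≡s+m)) s∈S)
      (λ d+m∈S → d + m , d+m∈S , d+m≢m , sym (x≡y+m⇒x+m≡y refl))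
      where
      d+m≢m : d + m ≢ m
      d+m≢m d+m≡m = d≢0 (trans (sym (x≡y+m⇒x+m≡y (sym d+m≡m))) m+m≡0)

    module _ (φ : Aut (Cay (shiftSet S))) where

      private
        f : G → G
        f = apply φ

      preserves-shifted-differences : ∀ u v → S (v - u + m) ⇔ S (f v - f u + m)
      preserves-shifted-differences u v with u ≟G v
      ... | yes refl = ≡⇒ (cong (λ d → S (d + m)) (trans (inverseʳ u) (sym (inverseʳ (f u)))))
      ... | no u≢v = begin
        S (v - u + m)           ∼⟨ ⇔-sym (shiftSet⇔ (λ e → u≢v (sym (x∙y⁻¹≈ε⇒x≈y v u e)))) ⟩
        shiftSet S (v - u)      ∼⟨ Aut.adj φ u v ⟩
        shiftSet S (f v - f u)  ∼⟨ shiftSet⇔ fv-fu≢0 ⟩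
        S (f v - f u + m)       ∎
        where
        open EquationalReasoning
        fv-fu≢0 : f v - f u ≢ 0#
        fv-fu≢0 e = u≢v (Injection.injective (↔⇒↣ (Aut.perm φ)) (sym (x∙y⁻¹≈ε⇒x≈y _ _ e)))

      layerPerm : Bool → G ↔ G
      layerPerm i = conjugate-↔ (shift i) (shift-involutive i) (Aut.perm φ)

      layerPerm-adjacency : ∀ {i j} → i ≢ j → ∀ a b →
        S (b - a) ⇔ S (Inverse.to (layerPerm j) b - Inverse.to (layerPerm i) a)
      layerPerm-adjacency {i} {j} i≢j a b = begin
        S (b - a)
          ≡⟨ cong S b-a≡shifted ⟩
        S (shift j b - shift i a + m)
          ∼⟨ preserves-shifted-differences (shift i a) (shift j b) ⟩
        S (f (shift j b) - f (shift i a) + m)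
          ≡⟨ cong S (sym (shift-difference i≢j _ _)) ⟩
        S (Inverse.to (layerPerm j) b - Inverse.to (layerPerm i) a)
          ∎
        where
        open EquationalReasoning
        b-a≡shifted : b - a ≡ shift j b - shift i a + m
        b-a≡shifted = trans (cong₂ _-_ (sym (shift-involutive j b)) (sym (shift-involutive i a)))
                     (shift-difference i≢j (shift i a) (shift j b))

      twist : Aut (Cay S ×G K₂)
      twist = record
        { perm = layerwise-↔ layerPerm
        ; adj  = λ (a , i) (b , j) → mk⇔
            (λ (s , i≢j) → Equivalence.to   (layerPerm-adjacency i≢j a b) s , i≢j)
            (λ (s , i≢j) → Equivalence.from (layerPerm-adjacency i≢j a b) s , i≢j)
        }

    automorphism-moving-m⇒unstable : (φ : Aut (Cay (shiftSet S))) →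
      apply φ 0# ≡ 0# → apply φ m ≢ m → Unstable (Cay S)
    automorphism-moving-m⇒unstable φ φ0≡0 φm≢m stable = φm≢m (begin
      f m                ≡⟨ cong f (identityˡ m) ⟨
      f (0# + m)         ≡⟨ x≡y+m⇒x+m≡y layers-agree ⟨
      f 0# + m           ≡⟨ cong (_+ m) φ0≡0 ⟩
      0# + m             ≡⟨ identityˡ m ⟩
      m                  ∎)
      where
      open ≡-Reasoning
      f : G → G
      f = apply φ
      layers-agree : f 0# ≡ f (0# + m) + m
      layers-agree = Stable⇒layers-agree stable (twist φ) 0#

module CyclicGroup (m : ℕ) {{_ : NonZero m}} where

  open Cyclic m

  private instance
    N-nonZero : NonZero N
    N-nonZero = nzN

  [_] : ℕ → ZZ
  [ a ] = a mod N

  toℕ-[] : ∀ a → toℕ [ a ] ≡ a % N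
  toℕ-[] a = toℕ-fromℕ< (m%n<n a N)

  []-cong-% : ∀ {a b} → a % N ≡ b % N → [ a ] ≡ [ b ]
  []-cong-% {a} {b} eq = toℕ-injective (trans (toℕ-[] a) (trans eq (sym (toℕ-[] b))))

  [toℕ]≡ : ∀ x → [ toℕ x ] ≡ x
  [toℕ]≡ x = toℕ-injective (trans (toℕ-[] (toℕ x)) (m<n⇒m%n≡m (toℕ<n x)))

  []-homo : ∀ a b → [ a ] ⊕ [ b ] ≡ [ a +ℕ b ]
  []-homo a b = []-cong-% (begin
    (toℕ [ a ] +ℕ toℕ [ b ]) % N  ≡⟨ cong₂ (λ x y → (x +ℕ y) % N) (toℕ-[] a) (toℕ-[] b) ⟩
    (a % N +ℕ b % N) % N          ≡⟨ %-distribˡ-+ a b N ⟨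
    (a +ℕ b) % N                  ∎)
    where open ≡-Reasoning

  [N]≡𝟘 : [ N ] ≡ 𝟘
  [N]≡𝟘 = []-cong-% ([m+n]%n≡m%n 0 N)

  ⊕-comm : ∀ x y → x ⊕ y ≡ y ⊕ x
  ⊕-comm x y = cong [_] (+-comm (toℕ x) (toℕ y))

  ⊕-assoc : ∀ x y z → (x ⊕ y) ⊕ z ≡ x ⊕ (y ⊕ z)
  ⊕-assoc x y z = begin
    (x ⊕ y) ⊕ z                          ≡⟨ cong ((x ⊕ y) ⊕_) ([toℕ]≡ z) ⟨
    [ toℕ x +ℕ toℕ y ] ⊕ [ toℕ z ]       ≡⟨ []-homo (toℕ x +ℕ toℕ y) (toℕ z) ⟩
    [ toℕ x +ℕ toℕ y +ℕ toℕ z ]          ≡⟨ cong [_] (+-assoc (toℕ x) (toℕ y) (toℕ z)) ⟩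
    [ toℕ x +ℕ (toℕ y +ℕ toℕ z) ]        ≡⟨ []-homo (toℕ x) (toℕ y +ℕ toℕ z) ⟨
    [ toℕ x ] ⊕ [ toℕ y +ℕ toℕ z ]       ≡⟨ cong (_⊕ (y ⊕ z)) ([toℕ]≡ x) ⟩
    x ⊕ (y ⊕ z)                          ∎
    where open ≡-Reasoning

  ⊕-identityˡ : ∀ x → 𝟘 ⊕ x ≡ x
  ⊕-identityˡ x = begin
    𝟘 ⊕ x          ≡⟨ cong (𝟘 ⊕_) ([toℕ]≡ x) ⟨
    [ 0 ] ⊕ [ toℕ x ] ≡⟨ []-homo 0 (toℕ x) ⟩
    [ toℕ x ]      ≡⟨ [toℕ]≡ x ⟩
    x              ∎
    where open ≡-Reasoning

  ⊖-inverseˡ : ∀ x → (⊖ x) ⊕ x ≡ 𝟘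
  ⊖-inverseˡ x = begin
    (⊖ x) ⊕ x                  ≡⟨ cong ((⊖ x) ⊕_) ([toℕ]≡ x) ⟨
    [ N ∸ toℕ x ] ⊕ [ toℕ x ]  ≡⟨ []-homo (N ∸ toℕ x) (toℕ x) ⟩
    [ N ∸ toℕ x +ℕ toℕ x ]     ≡⟨ cong [_] (m∸n+n≡m (<⇒≤ (toℕ<n x))) ⟩
    [ N ]                      ≡⟨ [N]≡𝟘 ⟩
    𝟘                          ∎
    where open ≡-Reasoning

  isAbelianGroup : IsAbelianGroup _≡_ _⊕_ 𝟘 ⊖_
  isAbelianGroup = record
    { isGroup = record
      { isMonoid = record
        { isSemigroup = record
          { isMagma = record { isEquivalence = isEquivalence ; ∙-cong = cong₂ _⊕_ }
          ; assoc   = ⊕-assoc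
          }
        ; identity = comm∧idˡ⇒id ⊕-comm ⊕-identityˡ
        }
      ; inverse = comm∧invˡ⇒inv ⊕-comm ⊖-inverseˡ
      ; ⁻¹-cong = cong ⊖_
      }
    ; comm = ⊕-comm
    }

  𝕞⊕𝕞≡𝟘 : 𝕞 ⊕ 𝕞 ≡ 𝟘
  𝕞⊕𝕞≡𝟘 = trans ([]-homo m m) [N]≡𝟘

theorem1p4 : (m : ℕ) {{m≢0 : NonZero m}} (S : Subset (Cyclic.N m)) →
    Cyclic.InvClosed m S → Cyclic.𝟘 m ∉ S →
    Σ (Aut (Cyclic.Cay m (Cyclic.shiftSet m S))) (λ φ →
      (apply φ (Cyclic.𝟘 m) ≡ Cyclic.𝟘 m) × (apply φ (Cyclic.𝕞 m) ≢ Cyclic.𝕞 m)) →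
    Unstable (Cyclic.Cay m (λ x → x ∈ S))
theorem1p4 m S _ _ (φ , φ0≡0 , φm≢m) =
  automorphism-moving-m⇒unstable (_∈ S) φ φ0≡0 φm≢m
  where
  open CyclicGroup m
  open ShiftedCayley isAbelianGroup _≟_ (Cyclic.𝕞 m) 𝕞⊕𝕞≡𝟘
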